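{- Let $p\geq 3$ be a prime and let $k\geq 2$ be an even integer. Define colorings of $\mathbb{N}$: $\Delta_1(x)=i$, where $i$ is the non-negative integer with $x\in[2^i,2^{i+1}-1]$; $\Delta_2(x)=(x',\,x''\bmod p)$; $\Delta_3(x)=(\Delta_1(x),\Delta_2(x))$. For an infinite set $X=\{x_1<x_2<\cdots\}\subseteq\mathbb{N}$, let $X^*_{alt}=\{\sum^*_{j\in J}x_j:J\in\binom{\mathbb{N}}{k}\}$, and for a coloring $\Delta$ consider the patterns: (i') $X^*_{alt}$ is monochromatic; (ii') $X^*_{alt}$ is rainbow; (iii') $\Delta(\sum^*_{j\in J}x_j)=\Delta(\sum^*_{j\in I}x_j)$ if and only if $\max I=\max J$, for all $I,J\in\binom{\mathbb{N}}{k}$; (iv') $\Delta(\sum^*_{j\in J}x_j)=\Delta(\sum^*_{j\in I}x_j)$ if and only if $\min I=\min J$, for all $I,J\in\binom{\mathbb{N}}{k}$; (v') $\Delta(\sum^*_{j\in J}x_j)=\Delta(\sum^*_{j\in I}x_j)$ if and only if $\min I=\min J$ and $\max I=\max J$, for all $I,J\in\binom{\mathbb{N}}{k}$. (For $k=2$, (ii') and (v') coincide.) Then for every infinite set $X\subseteq\mathbb{N}$: the coloring $\Delta_1$ satisfies none of (i'), (ii'), (iv'), (v'); the coloring $\Delta_2$ satisfies none of (i'), (ii'), (iii'), (v'); and, for $k\geq 4$, the coloring $\Delta_3$ satisfies none of (i'), (ii'), (iii'), (iv').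
   Context: $\mathbb{N}$ denotes the set of positive integers; $\binom{\mathbb{N}}{k}$ is the set of $k$-element subsets of $\mathbb{N}$. For a positive integer $x$, $x'$ and $x''$ are the non-negative integers with $x=p^{x'}x''$ and $p\nmid x''$. The elements of $X$ are indexed increasingly, and for $J=\{j_1<\cdots<j_k\}$ ($k$ even), $\sum^*_{j\in J}x_j=x_{j_k}-x_{j_{k-1}}+x_{j_{k-2}}-\cdots+x_{j_2}-x_{j_1}$. Monochromatic: all elements receive the same color; rainbow: all elements receive pairwise distinct colors. -}

module Defs where

open import Data.Nat using (ℕ; zero; suc; _+_; _∸_; _<_; _≤_; NonZero; _/_; _%_)
open import Data.Nat.Divisibility using (_∣?_)
open import Data.Nat.Logarithm using (⌊log₂_⌋)
open import Data.Product using (_×_; _,_; proj₁; proj₂)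
open import Data.List using (List; []; _∷_; length; map; head; last)
open import Data.List.Relation.Unary.Linked using (Linked)
open import Data.Maybe using (Maybe; just; nothing)
open import Relation.Binary.PropositionalEquality using (_≡_)
open import Relation.Nullary using (yes; no)

-- An infinite set X = {x_1 < x_2 < ...} ⊆ ℕ (positive integers) is given by
-- its increasing enumeration x : ℕ → ℕ (index 0 plays the role of 1).
StrictlyIncreasing : (ℕ → ℕ) → Set
StrictlyIncreasing x = ∀ m n → m < n → x m < x n

record KSet (k : ℕ) : Set where
  constructor kset
  field
    idx  : List ℕ
    len  : length idx ≡ k
    incr : Linked _<_ idx
open KSet public

fromMaybe0 : Maybe ℕ → ℕ
fromMaybe0 (just a) = a
fromMaybe0 nothing  = 0

-- min J and max J (J is nonempty whenever k ≥ 1, so the default 0 is never used)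
minK : ∀ {k} → KSet k → ℕ
minK J = fromMaybe0 (head (idx J))

maxK : ∀ {k} → KSet k → ℕ
maxK J = fromMaybe0 (last (idx J))

-- For an increasing list a₁ < a₂ < ... < a_k (k even):
-- alt = (a₂ - a₁) + (a₄ - a₃) + ... = a_k - a_{k-1} + ... + a₂ - a₁.
alt : List ℕ → ℕ
alt []           = 0
alt (a ∷ [])     = a
alt (a ∷ b ∷ r)  = (b ∸ a) + alt r

altSum : (ℕ → ℕ) → ∀ {k} → KSet k → ℕ
altSum x J = alt (map x (idx J))

Δ₁ : ℕ → ℕ
Δ₁ x = ⌊log₂ x ⌋

-- p-adic decomposition with fuel: returns (x', x'') with x = p^{x'} x'', p ∤ x''
-- (fuel x suffices for x ≥ 1, p ≥ 2).
padic : (fuel p : ℕ) → .{{NonZero p}} → ℕ → ℕ × ℕ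
padic zero     p x = 0 , x
padic (suc f)  p x with p ∣? x
... | yes _ = let r = padic f p (x / p) in suc (proj₁ r) , proj₂ r
... | no  _ = 0 , x

Δ₂ : (p : ℕ) → .{{NonZero p}} → ℕ → ℕ × ℕ
Δ₂ p x = let r = padic x p x in proj₁ r , (proj₂ r % p)

Δ₃ : (p : ℕ) → .{{NonZero p}} → ℕ → ℕ × (ℕ × ℕ)
Δ₃ p x = Δ₁ x , Δ₂ p x

module Patterns {C : Set} (Δ : ℕ → C) (x : ℕ → ℕ) (k : ℕ) where
  Mono : Set
  Mono = ∀ (I J : KSet k) → Δ (altSum x I) ≡ Δ (altSum x J)

  Rainbow : Set
  Rainbow = ∀ (I J : KSet k) → Δ (altSum x I) ≡ Δ (altSum x J) → idx I ≡ idx J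

  MaxPat : Set
  MaxPat = ∀ (I J : KSet k) →
    (Δ (altSum x J) ≡ Δ (altSum x I) → maxK I ≡ maxK J) ×
    (maxK I ≡ maxK J → Δ (altSum x J) ≡ Δ (altSum x I))

  MinPat : Set
  MinPat = ∀ (I J : KSet k) →
    (Δ (altSum x J) ≡ Δ (altSum x I) → minK I ≡ minK J) ×
    (minK I ≡ minK J → Δ (altSum x J) ≡ Δ (altSum x I))

  MinMaxPat : Set
  MinMaxPat = ∀ (I J : KSet k) →
    (Δ (altSum x J) ≡ Δ (altSum x I) → (minK I ≡ minK J × maxK I ≡ maxK J)) ×
    ((minK I ≡ minK J × maxK I ≡ maxK J) → Δ (altSum x J) ≡ Δ (altSum x I))

open Patterns public

module Submission where

open import Data.Empty using (⊥-elim)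
open import Data.Fin using (Fin; toℕ; fromℕ<)
open import Data.Fin.Properties using (pigeonhole; toℕ-fromℕ<)
open import Data.List using (List; []; _∷_; _++_; length; map; head; last)
open import Data.List.Properties using (length-++; ++-identityʳ; ∷-injectiveˡ; ∷-injectiveʳ)
open import Data.List.Relation.Unary.Linked using (Linked; [-]; _∷_; tail)
open import Data.Nat
open import Data.Nat.Divisibility
open import Data.Nat.DivMod
open import Data.Nat.Induction using (<-wellFounded)
open import Data.Nat.Logarithm
open import Data.Nat.Primality using (Prime; prime⇒nonZero)
open import Data.Nat.Properties
open import Algebra.Properties.CommutativeSemigroup +-commutativeSemigroup
  using (xy∙z≈xz∙y; xy∙z≈yz∙x; x∙yz≈xz∙y)
open import Data.Product using (∃-syntax; _×_; _,_; proj₁; proj₂)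
open import Data.Sum using (_⊎_; inj₁; inj₂; [_,_]′) renaming (map to ⊎-map)
open import Function using (_∘_)
open import Induction.InfiniteDescent using (InfiniteDescendingSequence; Descent; descent∧wf⇒empty)
open import Relation.Binary.PropositionalEquality
  using (_≡_; _≢_; refl; sym; trans; cong; cong₂; subst; subst₂; module ≡-Reasoning)
open import Relation.Nullary using (¬_; yes; no)

open import Defs

-- Every witness is a family of k-sets whose alternating sums differ by gaps x_j′ − x_j, so each colouring
-- is probed on chains s ≤ s + t ≤ s + t + u.
-- Δ₁: moving the second index makes a sum arbitrarily large, while for t + u ≤ s two adjacent members of the
-- chain lie in one dyadic interval [2^i, 2^(i+1)).
-- Δ₂: adding a multiple of p^(v+1) to a number of p-adic valuation ≤ v does not change Δ₂. Pigeonhole on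
-- x mod p^(D+1) supplies such gaps, and of two sums differing by D = x_{e+1} − x_e one has valuation ≤ D.
-- Conversely, if Δ₂ were constant on the sets {j, b, b+1, …} (j < b), every gap x_{j+1} − x_j below b would be
-- divisible by p^(v+1), so an alternating sum over k consecutive indices below b has valuation > v; under (iii')
-- for Δ₃ this makes the valuations of such sums decrease forever.
-- Δ₃ (k ≥ 4): two independent gaps t, u divisible by p^(D+1) give a chain whose members all share Δ₂, and two
-- adjacent ones also share Δ₁.

%-≡⇒∣∸ : ∀ d .{{_ : NonZero d}} m n → m % d ≡ n % d → d ∣ n ∸ m
%-≡⇒∣∸ d m n eq = divides (n / d ∸ m / d) (begin
    n ∸ m
  ≡⟨ cong₂ _∸_ (m≡m%n+[m/n]*n n d) (m≡m%n+[m/n]*n m d) ⟩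
    (n % d + n / d * d) ∸ (m % d + m / d * d)
  ≡⟨ cong (λ r → (n % d + n / d * d) ∸ (r + m / d * d)) eq ⟩
    (n % d + n / d * d) ∸ (n % d + m / d * d)
  ≡⟨ [m+n]∸[m+o]≡n∸o (n % d) _ _ ⟩
    n / d * d ∸ m / d * d
  ≡⟨ *-distribʳ-∸ d (n / d) (m / d) ⟨
    (n / d ∸ m / d) * d ∎)
  where open ≡-Reasoning

m∸o≡[m∸n]+[n∸o] : ∀ {m n o} → o ≤ n → n ≤ m → m ∸ o ≡ (m ∸ n) + (n ∸ o)
m∸o≡[m∸n]+[n∸o] {m} {n} {o} o≤n n≤m = begin
  m ∸ o             ≡⟨ cong (_∸ o) (m∸n+n≡m n≤m) ⟨
  (m ∸ n) + n ∸ o   ≡⟨ +-∸-assoc (m ∸ n) o≤n ⟩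
  (m ∸ n) + (n ∸ o) ∎
  where open ≡-Reasoning

m+[2+n]≡2+[m+n] : ∀ m n → m + suc (suc n) ≡ suc (suc (m + n))
m+[2+n]≡2+[m+n] m n = trans (+-suc m (suc n)) (cong suc (+-suc m n))

n<m^n : ∀ {m} → 1 < m → ∀ n → n < m ^ n
n<m^n 1<m zero = z<s
n<m^n {m} 1<m (suc n) = begin-strict
    suc n      ≤⟨ n<m^n 1<m n ⟩
    m ^ n      <⟨ m<m*n (m ^ n) m 1<m ⟩
    m ^ n * m  ≡⟨ *-comm (m ^ n) m ⟩
    m ^ suc n  ∎
  where
  open ≤-Reasoning
  instance
    _ : NonZero m
    _ = >-nonZero (<⇒≤ 1<m)
    _ : NonZero (m ^ n)
    _ = m^n≢0 m n

^-monoʳ-∣ : ∀ m {n o} → n ≤ o → m ^ n ∣ m ^ o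
^-monoʳ-∣ m {n} {o} n≤o =
  divides (m ^ (o ∸ n)) (trans (cong (m ^_) (sym (m∸n+n≡m n≤o))) (^-distribˡ-+-* m (o ∸ n) n))

∤⇒nonZero : ∀ {d n} → ¬ d ∣ n → NonZero n
∤⇒nonZero {d} {zero}  d∤0 = ⊥-elim (d∤0 (d ∣0))
∤⇒nonZero {d} {suc _} _   = _

∤-either : ∀ {d m} n → 0 < m → m < d → ¬ d ∣ n + m ⊎ ¬ d ∣ n
∤-either {d} {m} n 0<m m<d with d ∣? n
... | no  d∤n = inj₂ d∤n
... | yes d∣n = inj₁ (λ d∣n+m → >⇒∤ {{>-nonZero 0<m}} m<d (∣m+n∣m⇒∣n d∣n+m d∣n))

record CongruentPair (f : ℕ → ℕ) (d lo : ℕ) : Set where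
  field
    c c′  : ℕ
    lo≤c  : lo ≤ c
    c<c′  : c < c′
    d∣gap : d ∣ f c′ ∸ f c

congruent-pair : ∀ (f : ℕ → ℕ) d .{{_ : NonZero d}} lo → CongruentPair f d lo
congruent-pair f d lo with pigeonhole (n<1+n d) (λ (i : Fin (suc d)) → fromℕ< (m%n<n (f (lo + toℕ i)) d))
... | i , j , i<j , same = record
  { c     = lo + toℕ i
  ; c′    = lo + toℕ j
  ; lo≤c  = m≤m+n lo (toℕ i)
  ; c<c′  = +-monoʳ-< lo i<j
  ; d∣gap = %-≡⇒∣∸ d _ _ (trans (sym (toℕ-fromℕ< _)) (trans (cong toℕ same) (toℕ-fromℕ< _)))
  }

noInfiniteDescent : ∀ (g : ℕ → ℕ) → ¬ InfiniteDescendingSequence _<_ g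
noInfiniteDescent g descending = descent∧wf⇒empty descent <-wellFounded (g 0) (0 , refl)
  where
  descent : Descent _<_ (λ v → ∃[ i ] g i ≡ v)
  descent (i , refl) = g (suc i) , descending i , suc i , refl

2*m≤n⇒⌊log₂m⌋<⌊log₂n⌋ : ∀ {m n} → 1 ≤ m → 2 * m ≤ n → ⌊log₂ m ⌋ < ⌊log₂ n ⌋
2*m≤n⇒⌊log₂m⌋<⌊log₂n⌋ {m} 1≤m 2m≤n =
  subst (_≤ _) (⌊log₂[2*b]⌋≡1+⌊log₂b⌋ m {{>-nonZero 1≤m}}) (⌊log₂⌋-mono-≤ 2m≤n)

⌊log₂⌋-collision : ∀ {m} n o → 1 ≤ m → n + o ≤ m →
  ⌊log₂ m ⌋ ≡ ⌊log₂ (m + n) ⌋ ⊎ ⌊log₂ (m + n) ⌋ ≡ ⌊log₂ (m + n + o) ⌋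
⌊log₂⌋-collision {m} n o 1≤m n+o≤m with ⌊log₂ m ⌋ ≟ ⌊log₂ (m + n) ⌋
... | yes eq  = inj₁ eq
... | no  neq = inj₂ (≤-antisym (⌊log₂⌋-mono-≤ (m≤m+n (m + n) o)) (begin
      ⌊log₂ (m + n + o) ⌋ ≤⟨ ⌊log₂⌋-mono-≤ m+n+o≤2m ⟩
      ⌊log₂ (2 * m) ⌋     ≡⟨ ⌊log₂[2*b]⌋≡1+⌊log₂b⌋ m {{>-nonZero 1≤m}} ⟩
      suc ⌊log₂ m ⌋       ≤⟨ ≤∧≢⇒< (⌊log₂⌋-mono-≤ (m≤m+n m n)) neq ⟩
      ⌊log₂ (m + n) ⌋     ∎))
  where
  open ≤-Reasoning
  m+n+o≤2m : m + n + o ≤ 2 * m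
  m+n+o≤2m = begin
    m + n + o   ≡⟨ +-assoc m n o ⟩
    m + (n + o) ≤⟨ +-monoʳ-≤ m n+o≤m ⟩
    m + m       ≡⟨ cong (m +_) (+-identityʳ m) ⟨
    2 * m       ∎

module Valuation (p : ℕ) {{_ : NonZero p}} (1<p : 1 < p) where

  ν unit : ℕ → ℕ
  ν s = proj₁ (padic s p s)
  unit s = proj₂ (padic s p s)

  padic-sound : ∀ f {s} → 1 ≤ s → s ≤ f →
    s ≡ p ^ proj₁ (padic f p s) * proj₂ (padic f p s) × ¬ p ∣ proj₂ (padic f p s)
  padic-sound zero 1≤s s≤0 = ⊥-elim (<⇒≱ 1≤s s≤0)
  padic-sound (suc f) {s} 1≤s s≤1+f with p ∣? s
  ... | no  p∤s = sym (*-identityˡ s) , p∤s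
  ... | yes p∣s = s≡ , proj₂ s/p-sound
    where
    instance
      _ : NonZero s
      _ = >-nonZero 1≤s
    v w : ℕ
    v = proj₁ (padic f p (s / p))
    w = proj₂ (padic f p (s / p))
    s/p-sound : s / p ≡ p ^ v * w × ¬ p ∣ w
    s/p-sound = padic-sound f (m≥n⇒m/n>0 (∣⇒≤ p∣s)) (≤-pred (≤-trans (m/n<m s p 1<p) s≤1+f))
    s≡ : s ≡ p ^ suc v * w
    s≡ = begin
      s               ≡⟨ m/n*n≡m p∣s ⟨
      s / p * p       ≡⟨ cong (_* p) (proj₁ s/p-sound) ⟩
      p ^ v * w * p   ≡⟨ *-comm (p ^ v * w) p ⟩
      p * (p ^ v * w) ≡⟨ *-assoc p (p ^ v) w ⟨
      p ^ suc v * w   ∎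
      where open ≡-Reasoning

  padic-exact : ∀ f v {w} → ¬ p ∣ w → v < f → padic f p (p ^ v * w) ≡ (v , w)
  padic-exact (suc f) zero {w} p∤w _ with p ∣? (p ^ zero * w)
  ... | yes p∣w = ⊥-elim (p∤w (subst (p ∣_) (*-identityˡ w) p∣w))
  ... | no  _   = cong (0 ,_) (*-identityˡ w)
  padic-exact (suc f) (suc v) {w} p∤w v<1+f with p ∣? (p ^ suc v * w)
  ... | no  p∤  = ⊥-elim (p∤ (subst (p ∣_) (sym (*-assoc p (p ^ v) w)) (m∣m*n (p ^ v * w))))
  ... | yes _   = cong (λ r → suc (proj₁ r) , proj₂ r)
                    (trans (cong (padic f p) p^[1+v]w/p≡) (padic-exact f v p∤w (≤-pred v<1+f)))
    where
    p^[1+v]w/p≡ : p ^ suc v * w / p ≡ p ^ v * w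
    p^[1+v]w/p≡ = trans (cong (_/ p) (trans (*-assoc p (p ^ v) w) (*-comm p _))) (m*n/n≡m (p ^ v * w) p)

  Δ₂-char : ∀ v {w} → ¬ p ∣ w → Δ₂ p (p ^ v * w) ≡ (v , w % p)
  Δ₂-char v {w} p∤w =
    cong (λ r → proj₁ r , proj₂ r % p)
      (padic-exact (p ^ v * w) v p∤w (<-≤-trans (n<m^n 1<p v) (m≤m*n (p ^ v) w {{∤⇒nonZero p∤w}})))

  factorisation : ∀ {s} → 1 ≤ s → s ≡ p ^ ν s * unit s
  factorisation 1≤s = proj₁ (padic-sound _ 1≤s ≤-refl)

  p∤unit : ∀ {s} → 1 ≤ s → ¬ p ∣ unit s
  p∤unit 1≤s = proj₂ (padic-sound _ 1≤s ≤-refl)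

  p^ν∣ : ∀ {s} → 1 ≤ s → p ^ ν s ∣ s
  p^ν∣ {s} 1≤s = divides (unit s) (trans (factorisation 1≤s) (*-comm (p ^ ν s) (unit s)))

  p^[1+ν]∤ : ∀ {s} → 1 ≤ s → ¬ p ^ suc (ν s) ∣ s
  p^[1+ν]∤ {s} 1≤s p^[1+ν]∣s = p∤unit 1≤s (*-cancelˡ-∣ (p ^ ν s) {{m^n≢0 p (ν s)}}
    (subst₂ _∣_ (*-comm p (p ^ ν s)) (factorisation 1≤s) p^[1+ν]∣s))

  p^[1+v]∣⇒v<ν : ∀ {s v} → 1 ≤ s → p ^ suc v ∣ s → v < ν s
  p^[1+v]∣⇒v<ν 1≤s p^[1+v]∣s =
    ≰⇒> (λ ν≤v → p^[1+ν]∤ 1≤s (∣-trans (^-monoʳ-∣ p (s≤s ν≤v)) p^[1+v]∣s))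

  p^[1+v]∤⇒ν≤v : ∀ {s v} → 1 ≤ s → ¬ p ^ suc v ∣ s → ν s ≤ v
  p^[1+v]∤⇒ν≤v 1≤s p^[1+v]∤s =
    ≮⇒≥ (λ v<ν → p^[1+v]∤s (∣-trans (^-monoʳ-∣ p v<ν) (p^ν∣ 1≤s)))

  Δ₂-+ : ∀ {s t} → 1 ≤ s → p ^ suc (ν s) ∣ t → Δ₂ p (s + t) ≡ Δ₂ p s
  Δ₂-+ {s} {t} 1≤s (divides q t≡) = begin
      Δ₂ p (s + t)                         ≡⟨ cong (Δ₂ p) s+t≡ ⟩
      Δ₂ p (p ^ ν s * (unit s + p * q))    ≡⟨ Δ₂-char (ν s) p∤ ⟩
      (ν s , (unit s + p * q) % p)         ≡⟨ cong (ν s ,_) (%-remove-+ʳ (unit s) (m∣m*n q)) ⟩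
      Δ₂ p s                               ∎
    where
    open ≡-Reasoning
    a : ℕ
    a = p ^ ν s
    s+t≡ : s + t ≡ a * (unit s + p * q)
    s+t≡ = begin
      s + t                   ≡⟨ cong₂ _+_ (factorisation 1≤s) t≡ ⟩
      a * unit s + q * (p * a) ≡⟨ cong (a * unit s +_) (*-comm q (p * a)) ⟩
      a * unit s + p * a * q   ≡⟨ cong (λ r → a * unit s + r * q) (*-comm p a) ⟩
      a * unit s + a * p * q   ≡⟨ cong (a * unit s +_) (*-assoc a p q) ⟩
      a * unit s + a * (p * q) ≡⟨ *-distribˡ-+ a (unit s) (p * q) ⟨
      a * (unit s + p * q)     ∎
    p∤ : ¬ p ∣ unit s + p * q
    p∤ p∣ = p∤unit 1≤s (∣m+n∣m⇒∣n (subst (p ∣_) (+-comm (unit s) (p * q)) p∣) (m∣m*n q))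

  Δ₂-+-∣ : ∀ {s t v} → 1 ≤ s → ¬ p ^ suc v ∣ s → p ^ suc v ∣ t → Δ₂ p (s + t) ≡ Δ₂ p s
  Δ₂-+-∣ {v = v} 1≤s ∤s ∣t =
    Δ₂-+ 1≤s (∣-trans (^-monoʳ-∣ p (s≤s (p^[1+v]∤⇒ν≤v {v = v} 1≤s ∤s))) ∣t)

  Δ₂-≡⇒p^[1+ν]∣ : ∀ {s t} → 1 ≤ s → Δ₂ p s ≡ Δ₂ p (s + t) → p ^ suc (ν s) ∣ t
  Δ₂-≡⇒p^[1+ν]∣ {s} {t} 1≤s same =
    subst₂ _∣_ (*-comm (p ^ ν s) p) t≡
      (*-monoʳ-∣ (p ^ ν s) (%-≡⇒∣∸ p (unit s) (unit s′) (cong proj₂ same)))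
    where
    open ≡-Reasoning
    s′ : ℕ
    s′ = s + t
    t≡ : p ^ ν s * (unit s′ ∸ unit s) ≡ t
    t≡ = begin
      p ^ ν s * (unit s′ ∸ unit s)          ≡⟨ *-distribˡ-∸ (p ^ ν s) (unit s′) (unit s) ⟩
      p ^ ν s * unit s′ ∸ p ^ ν s * unit s  ≡⟨ cong (λ v → p ^ v * unit s′ ∸ p ^ ν s * unit s)
                                                     (cong proj₁ same) ⟩
      p ^ ν s′ * unit s′ ∸ p ^ ν s * unit s ≡⟨ cong₂ _∸_ (factorisation (≤-trans 1≤s (m≤m+n s t)))
                                                       (factorisation 1≤s) ⟨
      s′ ∸ s                                ≡⟨ m+n∸m≡n s t ⟩
      t                                     ∎

  Δ₃-collision : ∀ {s t u v} → 1 ≤ s → ¬ p ^ suc v ∣ s → p ^ suc v ∣ t → p ^ suc v ∣ u →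
    t + u ≤ s →
    Δ₃ p s ≡ Δ₃ p (s + t) ⊎ Δ₃ p (s + t) ≡ Δ₃ p (s + t + u)
  Δ₃-collision {s} {t} {u} {v} 1≤s ∤s ∣t ∣u t+u≤s =
    ⊎-map (λ eq → cong₂ _,_ eq (sym Δ₂[s+t]))
          (λ eq → cong₂ _,_ eq (trans Δ₂[s+t] (sym Δ₂[s+t+u])))
          (⌊log₂⌋-collision t u 1≤s t+u≤s)
    where
    Δ₂[s+t] : Δ₂ p (s + t) ≡ Δ₂ p s
    Δ₂[s+t] = Δ₂-+-∣ {v = v} 1≤s ∤s ∣t
    Δ₂[s+t+u] : Δ₂ p (s + t + u) ≡ Δ₂ p s
    Δ₂[s+t+u] = trans (cong (Δ₂ p) (+-assoc s t u)) (Δ₂-+-∣ {v = v} 1≤s ∤s (∣m∣n⇒∣m+n ∣t ∣u))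

record Coincidence {C : Set} (Δ : ℕ → C) (x : ℕ → ℕ) (k : ℕ) (Differ : KSet k → KSet k → Set) : Set where
  constructor coincidence
  field
    I J        : KSet k
    sameColour : Δ (altSum x I) ≡ Δ (altSum x J)
    differ     : Differ I J

record Discrepancy {C : Set} (Δ : ℕ → C) (x : ℕ → ℕ) (k : ℕ) : Set where
  constructor discrepancy
  field
    I J            : KSet k
    sameMin        : minK I ≡ minK J
    distinctColour : Δ (altSum x I) ≢ Δ (altSum x J)

Distinct DistinctMin DistinctMax : ∀ {k} → KSet k → KSet k → Set
Distinct    I J = idx I ≢ idx J
DistinctMin I J = minK I ≢ minK J
DistinctMax I J = maxK I ≢ maxK J

module _ {C : Set} {Δ : ℕ → C} {x : ℕ → ℕ} {k : ℕ} where

  distinctMin⇒distinct : Coincidence Δ x k DistinctMin → Coincidence Δ x k Distinct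
  distinctMin⇒distinct (coincidence I J same min≢) = coincidence I J same (min≢ ∘ cong (fromMaybe0 ∘ head))

  distinctMax⇒distinct : Coincidence Δ x k DistinctMax → Coincidence Δ x k Distinct
  distinctMax⇒distinct (coincidence I J same max≢) = coincidence I J same (max≢ ∘ cong (fromMaybe0 ∘ last))

  coincidence⇒¬Rainbow : Coincidence Δ x k Distinct → ¬ Rainbow Δ x k
  coincidence⇒¬Rainbow (coincidence I J same differ) rainbow = differ (rainbow I J same)

  coincidence⇒¬MinPat : Coincidence Δ x k DistinctMin → ¬ MinPat Δ x k
  coincidence⇒¬MinPat (coincidence I J same differ) minPat = differ (proj₁ (minPat I J) (sym same))

  coincidence⇒¬MaxPat : Coincidence Δ x k DistinctMax → ¬ MaxPat Δ x k
  coincidence⇒¬MaxPat (coincidence I J same differ) maxPat = differ (proj₁ (maxPat I J) (sym same))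

  coincidence⇒¬MinMaxPat-min : Coincidence Δ x k DistinctMin → ¬ MinMaxPat Δ x k
  coincidence⇒¬MinMaxPat-min (coincidence I J same differ) pat = differ (proj₁ (proj₁ (pat I J) (sym same)))

  coincidence⇒¬MinMaxPat-max : Coincidence Δ x k DistinctMax → ¬ MinMaxPat Δ x k
  coincidence⇒¬MinMaxPat-max (coincidence I J same differ) pat = differ (proj₂ (proj₁ (pat I J) (sym same)))

  chain-coincidence : ∀ {R : KSet k → KSet k → Set} (A B C : KSet k) {s t u} →
    altSum x A ≡ s → altSum x B ≡ s + t → altSum x C ≡ s + t + u → R A B → R B C →
    Δ s ≡ Δ (s + t) ⊎ Δ (s + t) ≡ Δ (s + t + u) → Coincidence Δ x k R
  chain-coincidence A B C a b c rAB rBC (inj₁ eq) =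
    coincidence A B (trans (cong Δ a) (trans eq (cong Δ (sym b)))) rAB
  chain-coincidence A B C a b c rAB rBC (inj₂ eq) =
    coincidence B C (trans (cong Δ b) (trans eq (cong Δ (sym c)))) rBC

  discrepancy⇒¬Mono : Discrepancy Δ x k → ¬ Mono Δ x k
  discrepancy⇒¬Mono (discrepancy I J _ distinct) mono = distinct (mono I J)

  discrepancy⇒¬MinPat : Discrepancy Δ x k → ¬ MinPat Δ x k
  discrepancy⇒¬MinPat (discrepancy I J sameMin distinct) minPat = distinct (sym (proj₂ (minPat I J) sameMin))

discrepancy-∘ : ∀ {C C′ : Set} (f : C → C′) {Δ : ℕ → C} {x k} →
  Discrepancy (f ∘ Δ) x k → Discrepancy Δ x k
discrepancy-∘ f (discrepancy I J sameMin distinct) = discrepancy I J sameMin (distinct ∘ cong f)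

pairsFrom : ℕ → ℕ → List ℕ
pairsFrom zero    s = []
pairsFrom (suc m) s = s ∷ suc s ∷ pairsFrom m (suc (suc s))

length-pairsFrom : ∀ m s → length (pairsFrom m s) ≡ m * 2
length-pairsFrom zero    s = refl
length-pairsFrom (suc m) s = cong (2 +_) (length-pairsFrom m (2 + s))

pairsFrom-linked : ∀ m {a r} → Linked _<_ (a + m * 2 ∷ r) → Linked _<_ (a ∷ pairsFrom m (suc a) ++ r)
pairsFrom-linked zero {a} {r} h = subst (λ b → Linked _<_ (b ∷ r)) (+-identityʳ a) h
pairsFrom-linked (suc m) {a} {r} h =
  n<1+n a ∷ n<1+n (suc a) ∷ pairsFrom-linked m (subst (λ b → Linked _<_ (b ∷ r)) (m+[2+n]≡2+[m+n] a (m * 2)) h)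

last-++-∷ : ∀ {A : Set} (xs : List A) {y ys} → last (xs ++ y ∷ ys) ≡ last (y ∷ ys)
last-++-∷ []           = refl
last-++-∷ (_ ∷ [])     = refl
last-++-∷ (_ ∷ z ∷ zs) = last-++-∷ (z ∷ zs)

module Increasing (x : ℕ → ℕ) (x-inc : StrictlyIncreasing x) (x-pos : ∀ n → 1 ≤ x n) where

  S : List ℕ → ℕ
  S l = alt (map x l)

  x-mono : ∀ {m n} → m ≤ n → x m ≤ x n
  x-mono m≤n with m≤n⇒m<n∨m≡n m≤n
  ... | inj₁ m<n  = <⇒≤ (x-inc _ _ m<n)
  ... | inj₂ refl = ≤-refl

  n<x : ∀ n → n < x n
  n<x zero    = x-pos 0
  n<x (suc n) = ≤-<-trans (n<x n) (x-inc n (suc n) (n<1+n n))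

  x-gap-pos : ∀ {m n} → m < n → 1 ≤ x n ∸ x m
  x-gap-pos m<n = m<n⇒0<n∸m (x-inc _ _ m<n)

  x-gap-split : ∀ {i j l} → i ≤ j → j ≤ l → x l ∸ x i ≡ (x l ∸ x j) + (x j ∸ x i)
  x-gap-split i≤j j≤l = m∸o≡[m∸n]+[n∸o] (x-mono i≤j) (x-mono j≤l)

  S-pairsFrom-++ : ∀ m s r → S (pairsFrom m s ++ r) ≡ S (pairsFrom m s) + S r
  S-pairsFrom-++ zero    s r = refl
  S-pairsFrom-++ (suc m) s r =
    trans (cong (x (suc s) ∸ x s +_) (S-pairsFrom-++ m (2 + s) r))
          (sym (+-assoc (x (suc s) ∸ x s) (S (pairsFrom m (2 + s))) (S r)))

  pairsFrom-∣ : ∀ {d} m s {b} → s + m * 2 ≤ b → (∀ j → suc j < b → d ∣ x (suc j) ∸ x j) →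
    d ∣ S (pairsFrom m s)
  pairsFrom-∣ zero    s _ _ = _ ∣0
  pairsFrom-∣ (suc m) s {b} s+2m+2≤b gaps =
    ∣m∣n⇒∣m+n (gaps s (≤-trans (s≤s (s≤s (m≤m+n s _))) 2+s+2m≤b))
              (pairsFrom-∣ m (2 + s) 2+s+2m≤b gaps)
    where
    2+s+2m≤b : 2 + s + m * 2 ≤ b
    2+s+2m≤b = subst (_≤ b) (m+[2+n]≡2+[m+n] s (m * 2)) s+2m+2≤b

  module Sets (m : ℕ) where

    k : ℕ
    k = suc m * 2

    lower : ℕ → ℕ → List ℕ
    lower j b = j ∷ b ∷ pairsFrom m (suc b)

    lowerSet : ∀ {j b} → j < b → KSet k
    lowerSet {j} {b} j<b = kset (lower j b) (cong (2 +_) (length-pairsFrom m (suc b)))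
      (j<b ∷ subst (Linked _<_ ∘ (b ∷_)) (++-identityʳ _) (pairsFrom-linked m [-]))

    S-lower-pos : ∀ {j b} → j < b → 1 ≤ S (lower j b)
    S-lower-pos j<b = ≤-trans (x-gap-pos j<b) (m≤m+n _ _)

    S-lower-shift : ∀ {j j′ b} → j ≤ j′ → j′ ≤ b → S (lower j b) ≡ S (lower j′ b) + (x j′ ∸ x j)
    S-lower-shift {j} {j′} {b} j≤j′ j′≤b =
      trans (cong (_+ S (pairsFrom m (suc b))) (x-gap-split j≤j′ j′≤b))
            (xy∙z≈xz∙y (x b ∸ x j′) (x j′ ∸ x j) _)

    upper : ℕ → ℕ → List ℕ
    upper e c = pairsFrom m 1 ++ e ∷ c ∷ []

    upperSet : ∀ {e c} → m * 2 < e → e < c → KSet k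
    upperSet {e} {c} 2m<e e<c = kset (upper e c) length-upper (tail (pairsFrom-linked m (2m<e ∷ e<c ∷ [-])))
      where
      length-upper : length (upper e c) ≡ k
      length-upper = trans (length-++ (pairsFrom m 1)) (trans (cong (_+ 2) (length-pairsFrom m 1)) (+-comm (m * 2) 2))

    max-upperSet : ∀ {e c} (2m<e : m * 2 < e) (e<c : e < c) → maxK (upperSet 2m<e e<c) ≡ c
    max-upperSet _ _ = cong fromMaybe0 (last-++-∷ (pairsFrom m 1))

    S-upper : ∀ e c → S (upper e c) ≡ S (pairsFrom m 1) + (x c ∸ x e)
    S-upper e c = trans (S-pairsFrom-++ m 1 (e ∷ c ∷ [])) (cong (S (pairsFrom m 1) +_) (+-identityʳ _))

    S-upper-pos : ∀ {e c} → e < c → 1 ≤ S (upper e c)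
    S-upper-pos {e} {c} e<c = subst (1 ≤_) (sym (S-upper e c)) (≤-trans (x-gap-pos e<c) (m≤n+m _ _))

    S-upper-step : ∀ {e e′ c} → e ≤ e′ → e′ ≤ c → S (upper e c) ≡ S (upper e′ c) + (x e′ ∸ x e)
    S-upper-step {e} {e′} {c} e≤e′ e′≤c = begin
        S (upper e c)                      ≡⟨ S-upper e c ⟩
        B + (x c ∸ x e)                    ≡⟨ cong (B +_) (x-gap-split e≤e′ e′≤c) ⟩
        B + ((x c ∸ x e′) + (x e′ ∸ x e))  ≡⟨ +-assoc B _ _ ⟨
        (B + (x c ∸ x e′)) + (x e′ ∸ x e)  ≡⟨ cong (_+ (x e′ ∸ x e)) (S-upper e′ c) ⟨
        S (upper e′ c) + (x e′ ∸ x e)      ∎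
      where
      open ≡-Reasoning
      B : ℕ
      B = S (pairsFrom m 1)

    S-upper-extend : ∀ {e c c′} → e ≤ c → c ≤ c′ → S (upper e c′) ≡ S (upper e c) + (x c′ ∸ x c)
    S-upper-extend {e} {c} {c′} e≤c c≤c′ = begin
        S (upper e c′)                    ≡⟨ S-upper e c′ ⟩
        B + (x c′ ∸ x e)                  ≡⟨ cong (B +_) (x-gap-split e≤c c≤c′) ⟩
        B + ((x c′ ∸ x c) + (x c ∸ x e))  ≡⟨ x∙yz≈xz∙y B _ _ ⟩
        (B + (x c ∸ x e)) + (x c′ ∸ x c)  ≡⟨ cong (_+ (x c′ ∸ x c)) (S-upper e c) ⟨
        S (upper e c) + (x c′ ∸ x c)      ∎
      where
      open ≡-Reasoning
      B : ℕ
      B = S (pairsFrom m 1)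

    Δ₁-discrepancy : Discrepancy Δ₁ x k
    Δ₁-discrepancy = discrepancy (lowerSet {0} {1} z<s) (lowerSet 0<n) refl
      (λ eq → <-irrefl eq (2*m≤n⇒⌊log₂m⌋<⌊log₂n⌋ (S-lower-pos z<s) 2s≤))
      where
      s n : ℕ
      s = S (lower 0 1)
      n = 2 * s + x 0
      0<n : 0 < n
      0<n = ≤-trans (x-pos 0) (m≤n+m (x 0) (2 * s))
      2s≤ : 2 * s ≤ S (lower 0 n)
      2s≤ = ≤-trans (m+n≤o⇒m≤o∸n (2 * s) (<⇒≤ (n<x n))) (m≤m+n _ _)

    Δ₁-coincidence : Coincidence Δ₁ x k DistinctMin
    Δ₁-coincidence = chain-coincidence (lowerSet 2<n) (lowerSet 1<n) (lowerSet 0<n) refl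
      (S-lower-shift (n≤1+n 1) (<⇒≤ 2<n))
      (trans (S-lower-shift z≤n (<⇒≤ 1<n)) (cong (_+ (x 1 ∸ x 0)) (S-lower-shift (n≤1+n 1) (<⇒≤ 2<n))))
      (λ ()) (λ ())
      (⌊log₂⌋-collision (x 2 ∸ x 1) (x 1 ∸ x 0) (S-lower-pos 2<n) gaps≤)
      where
      n : ℕ
      n = x 2 + x 2
      2<n : 2 < n
      2<n = ≤-trans (n<x 2) (m≤m+n (x 2) (x 2))
      1<n : 1 < n
      1<n = <-trans (n<1+n 1) 2<n
      0<n : 0 < n
      0<n = <-trans z<s 1<n
      gaps≤ : (x 2 ∸ x 1) + (x 1 ∸ x 0) ≤ S (lower 2 n)
      gaps≤ = begin
        (x 2 ∸ x 1) + (x 1 ∸ x 0) ≡⟨ x-gap-split z≤n (n≤1+n 1) ⟨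
        x 2 ∸ x 0                 ≤⟨ m∸n≤m (x 2) (x 0) ⟩
        x 2                       ≤⟨ m+n≤o⇒m≤o∸n (x 2) (<⇒≤ (n<x n)) ⟩
        x n ∸ x 2                 ≤⟨ m≤m+n _ _ ⟩
        S (lower 2 n)             ∎
        where open ≤-Reasoning

    module Padic (p : ℕ) {{_ : NonZero p}} (1<p : 1 < p) where
      open Valuation p 1<p

      Δ₂-coincidence : Coincidence (Δ₂ p) x k DistinctMax
      Δ₂-coincidence =
        [ (λ M∤ → coincidenceAt e₀ (n<1+n _) (<-trans (n<1+n e₀) e₀+1<c)
                    (M∤ ∘ subst (M ∣_) (S-upper-step (n≤1+n e₀) (<⇒≤ e₀+1<c))))
        , coincidenceAt (suc e₀) (m<n⇒m<1+n (n<1+n _)) e₀+1<c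
        ]′ (∤-either {d = M} (S (upper (suc e₀) c)) (x-gap-pos (n<1+n e₀)) D<M)
        where
        e₀ D M : ℕ
        e₀ = suc (m * 2)
        D = x (suc e₀) ∸ x e₀
        M = p ^ suc D
        instance
          _ : NonZero M
          _ = m^n≢0 p (suc D)
        D<M : D < M
        D<M = <-trans (n<1+n D) (n<m^n 1<p (suc D))
        open CongruentPair (congruent-pair x M (2 + e₀))
          renaming (c′ to d; lo≤c to e₀+1<c; c<c′ to c<d; d∣gap to M∣gap)
        coincidenceAt : ∀ e → m * 2 < e → e < c → ¬ M ∣ S (upper e c) → Coincidence (Δ₂ p) x k DistinctMax
        coincidenceAt e 2m<e e<c M∤ =
          coincidence (upperSet 2m<e e<c) (upperSet 2m<e e<d)
            (sym (trans (cong (Δ₂ p) (S-upper-extend (<⇒≤ e<c) (<⇒≤ c<d)))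
                        (Δ₂-+-∣ {v = D} (S-upper-pos e<c) M∤ M∣gap)))
            (λ eq → <-irrefl (trans (sym (max-upperSet 2m<e e<c)) (trans eq (max-upperSet 2m<e e<d))) c<d)
          where
          e<d : e < d
          e<d = <-trans e<c c<d

      lower-sameColour⇒ν< : ∀ {b c} {colour : ℕ × ℕ} → (∀ j → j < b → Δ₂ p (S (lower j b)) ≡ colour) →
        c + k ≤ b → proj₁ colour < ν (S (pairsFrom (suc m) c))
      lower-sameColour⇒ν< {b} {c} {colour} sameColour c+k≤b =
        p^[1+v]∣⇒v<ν (S-lower-pos (n<1+n c)) (pairsFrom-∣ (suc m) c c+k≤b p^[1+v]∣gap)
        where
        p^[1+v]∣gap : ∀ j → suc j < b → p ^ suc (proj₁ colour) ∣ x (suc j) ∸ x j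
        p^[1+v]∣gap j 1+j<b = subst (λ v → p ^ suc v ∣ x (suc j) ∸ x j) (cong proj₁ (sameColour (suc j) 1+j<b))
          (Δ₂-≡⇒p^[1+ν]∣ (S-lower-pos 1+j<b)
            (trans (sameColour (suc j) 1+j<b)
              (trans (sym (sameColour j (<-trans (n<1+n j) 1+j<b)))
                (cong (Δ₂ p) (S-lower-shift (n≤1+n j) (<⇒≤ 1+j<b))))))

      Δ₂-¬Mono : ¬ Mono (Δ₂ p) x k
      Δ₂-¬Mono mono =
        <-irrefl refl (lower-sameColour⇒ν< {b = k} {c = 0}
                        (λ j j<k → mono (lowerSet j<k) (lowerSet {0} {1} z<s)) ≤-refl)

      Δ₃-¬MaxPat : ¬ MaxPat (Δ₃ p) x k
      Δ₃-¬MaxPat maxPat = noInfiniteDescent (λ i → ν (S (pairsFrom (suc m) (i * k)))) descending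
        where
        descending : ∀ i → ν (S (pairsFrom (suc m) (suc i * k))) < ν (S (pairsFrom (suc m) (i * k)))
        descending i = lower-sameColour⇒ν< {b = suc (suc i * k)} {c = i * k}
          (λ j j<b → cong proj₂ (proj₂ (maxPat (lowerSet (n<1+n (suc i * k))) (lowerSet j<b)) refl))
          (≤-trans (≤-reflexive (+-comm (i * k) k)) (n≤1+n _))

      Δ₃-discrepancy : Discrepancy (Δ₃ p) x k
      Δ₃-discrepancy = discrepancy-∘ proj₁ Δ₁-discrepancy

  module Hooks (m : ℕ) (p : ℕ) {{_ : NonZero p}} (1<p : 1 < p) where
    open Valuation p 1<p
    open Sets m using (lower; lowerSet; S-lower-shift)

    k D M : ℕ
    k = suc (suc m) * 2
    D = x 1 ∸ x 0
    M = p ^ suc D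
    instance
      _ : NonZero M
      _ = m^n≢0 p (suc D)

    open CongruentPair (congruent-pair x M 2)
      renaming (c to y₁; c′ to y₂; lo≤c to 2≤y₁; c<c′ to y₁<y₂; d∣gap to M∣t)
    open CongruentPair (congruent-pair x M (suc y₂))
      renaming (c to c₁; c′ to c₂; lo≤c to y₂<c₁; c<c′ to c₁<c₂; d∣gap to M∣u)

    n : ℕ
    n = x y₂ + x c₂ + x c₂

    c₂<n : c₂ < n
    c₂<n = <-≤-trans (n<x c₂) (m≤n+m (x c₂) (x y₂ + x c₂))

    hook : ℕ → ℕ → ℕ → List ℕ
    hook e y c = e ∷ y ∷ lower c n

    hookSet : ∀ {e y c} → e < y → y < c → c < n → KSet k
    hookSet {e} {y} {c} e<y y<c c<n =
      kset (hook e y c) (cong (2 +_) (len (lowerSet c<n))) (e<y ∷ y<c ∷ incr (lowerSet c<n))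

    coincidenceAt : ∀ e → e < y₁ → ¬ M ∣ S (hook e y₁ c₂) → Coincidence (Δ₃ p) x k Distinct
    coincidenceAt e e<y₁ M∤ =
      chain-coincidence (hookSet e<y₁ y₁<c₂ c₂<n) (hookSet e<y₂ y₂<c₂ c₂<n) (hookSet e<y₂ y₂<c₁ c₁<n)
        refl step-y step-c
        (λ eq → <-irrefl (∷-injectiveˡ (∷-injectiveʳ eq)) y₁<y₂)
        (λ eq → <-irrefl (sym (∷-injectiveˡ (∷-injectiveʳ (∷-injectiveʳ eq)))) c₁<c₂)
        (Δ₃-collision {v = D} (≤-trans (x-gap-pos e<y₁) (m≤m+n _ _)) M∤ M∣t M∣u gaps≤)
      where
      e<y₂ : e < y₂
      e<y₂ = <-trans e<y₁ y₁<y₂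
      y₂<c₂ : y₂ < c₂
      y₂<c₂ = <-trans y₂<c₁ c₁<c₂
      y₁<c₂ : y₁ < c₂
      y₁<c₂ = <-trans y₁<y₂ y₂<c₂
      c₁<n : c₁ < n
      c₁<n = <-trans c₁<c₂ c₂<n
      s t u L : ℕ
      s = S (hook e y₁ c₂)
      t = x y₂ ∸ x y₁
      u = x c₂ ∸ x c₁
      L = S (lower c₂ n)
      step-y : S (hook e y₂ c₂) ≡ s + t
      step-y = trans (cong (_+ L) (x-gap-split (<⇒≤ e<y₁) (<⇒≤ y₁<y₂))) (xy∙z≈yz∙x t _ L)
      step-c : S (hook e y₂ c₁) ≡ s + t + u
      step-c = begin
        (x y₂ ∸ x e) + S (lower c₁ n) ≡⟨ cong ((x y₂ ∸ x e) +_) (S-lower-shift (<⇒≤ c₁<c₂) (<⇒≤ c₂<n)) ⟩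
        (x y₂ ∸ x e) + (L + u)        ≡⟨ +-assoc (x y₂ ∸ x e) L u ⟨
        S (hook e y₂ c₂) + u          ≡⟨ cong (_+ u) step-y ⟩
        s + t + u                     ∎
        where open ≡-Reasoning
      gaps≤ : t + u ≤ s
      gaps≤ = begin
        t + u        ≤⟨ +-mono-≤ (m∸n≤m (x y₂) (x y₁)) (m∸n≤m (x c₂) (x c₁)) ⟩
        x y₂ + x c₂  ≤⟨ m+n≤o⇒m≤o∸n (x y₂ + x c₂) (<⇒≤ (n<x n)) ⟩
        x n ∸ x c₂   ≤⟨ m≤m+n _ _ ⟩
        L            ≤⟨ m≤n+m L (x y₁ ∸ x e) ⟩
        s            ∎
        where open ≤-Reasoning

    Δ₃-coincidence : Coincidence (Δ₃ p) x k Distinct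
    Δ₃-coincidence =
      [ (λ M∤ → coincidenceAt 0 (<-trans z<s 2≤y₁) (M∤ ∘ subst (M ∣_) step-e))
      , coincidenceAt 1 2≤y₁
      ]′ (∤-either {d = M} (S (hook 1 y₁ c₂)) (x-gap-pos z<s) (<-trans (n<1+n D) (n<m^n 1<p (suc D))))
      where
      step-e : S (hook 0 y₁ c₂) ≡ S (hook 1 y₁ c₂) + D
      step-e = trans (cong (_+ S (lower c₂ n)) (x-gap-split z≤n (<⇒≤ 2≤y₁)))
                     (xy∙z≈xz∙y (x y₁ ∸ x 1) D _)

lemma4p5 : (p : ℕ) (pp : Prime p) → 3 ≤ p →
    (k : ℕ) → 2 ≤ k → 2 ∣ k →
    (x : ℕ → ℕ) → StrictlyIncreasing x → (∀ n → 1 ≤ x n) →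
    (¬ Mono Δ₁ x k × ¬ Rainbow Δ₁ x k × ¬ MinPat Δ₁ x k × ¬ MinMaxPat Δ₁ x k)
    × (¬ Mono (Δ₂ p {{prime⇒nonZero pp}}) x k × ¬ Rainbow (Δ₂ p {{prime⇒nonZero pp}}) x k
       × ¬ MaxPat (Δ₂ p {{prime⇒nonZero pp}}) x k × ¬ MinMaxPat (Δ₂ p {{prime⇒nonZero pp}}) x k)
    × (4 ≤ k →
       ¬ Mono (Δ₃ p {{prime⇒nonZero pp}}) x k × ¬ Rainbow (Δ₃ p {{prime⇒nonZero pp}}) x k
       × ¬ MaxPat (Δ₃ p {{prime⇒nonZero pp}}) x k × ¬ MinPat (Δ₃ p {{prime⇒nonZero pp}}) x k)
lemma4p5 p pp _ .(zero * 2) () (divides zero refl) x x-inc x-pos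
lemma4p5 p pp 3≤p .(suc m * 2) _ (divides (suc m) refl) x x-inc x-pos =
    ( discrepancy⇒¬Mono Δ₁-discrepancy
    , coincidence⇒¬Rainbow (distinctMin⇒distinct Δ₁-coincidence)
    , coincidence⇒¬MinPat Δ₁-coincidence
    , coincidence⇒¬MinMaxPat-min Δ₁-coincidence )
  , ( Δ₂-¬Mono
    , coincidence⇒¬Rainbow (distinctMax⇒distinct Δ₂-coincidence)
    , coincidence⇒¬MaxPat Δ₂-coincidence
    , coincidence⇒¬MinMaxPat-max Δ₂-coincidence )
  , λ 4≤k →
    ( discrepancy⇒¬Mono Δ₃-discrepancy
    , Δ₃-¬Rainbow m 4≤k
    , Δ₃-¬MaxPat
    , discrepancy⇒¬MinPat Δ₃-discrepancy )
  where
  instance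
    _ : NonZero p
    _ = prime⇒nonZero pp
  1<p : 1 < p
  1<p = ≤-trans (n≤1+n 2) 3≤p
  open Increasing x x-inc x-pos
  open Sets m
  open Padic p 1<p
  Δ₃-¬Rainbow : ∀ m → 4 ≤ suc m * 2 → ¬ Rainbow (Δ₃ p) x (suc m * 2)
  Δ₃-¬Rainbow zero (s≤s (s≤s ()))
  Δ₃-¬Rainbow (suc m) _ = coincidence⇒¬Rainbow (Hooks.Δ₃-coincidence m p 1<p)
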